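{- Let $G$ be a directed graph with three vertices $b,g,v$ such that $v\to g$, $v\to b$ and $b\to g$ are edges of $G$. Let $G_1$ be the graph obtained from $G$ by deleting the edge $b\to g$, and let $G_2$ be obtained from $G$ by deleting the edges $v\to b$ and $b\to g$ and adding the edge $g\to b$. Then there is a sijection $$\mathrm{Topo}(G)\;\longleftrightarrow\;\mathrm{Topo}(G_1)-\mathrm{Topo}(G_2).$$
   Context: For a directed graph $G=(V,E)$, a topological ordering is a bijection $f:V\to\{1,\dots,|V|\}$ with $f(u)>f(w)$ for every edge $u\to w$; $\mathrm{Topo}(G)$ is the set of them, regarded as a signed set in which every element has weight $+1$. For signed sets, $A-B$ is the disjoint union of $A$ and a copy of $B$ with negated weights. A sijection between signed sets $S$ and $T$ is an involution $f$ on $S\sqcup T$ with $w(f(x))=-w(x)$ if $x,f(x)$ lie in the same one of $S,T$, and $w(f(x))=w(x)$ otherwise. -}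

module Defs where

open import Level using (0ℓ)
open import Data.Nat using (ℕ)
open import Data.Fin using (Fin; _<_)
open import Data.Sign using (Sign; opposite) renaming (+ to plus)
open import Data.Sum using (_⊎_; inj₁; inj₂)
open import Data.Product using (Σ; _×_; _,_; proj₁)
open import Relation.Nullary using (¬_)
open import Relation.Binary.PropositionalEquality using (_≡_; cong; refl; sym; trans)
open import Data.Empty using (⊥)
open import Function.Definitions using (Bijective)

Digraph : ℕ → Set₁
Digraph n = Fin n → Fin n → Set

deleteEdge : ∀ {n} → Digraph n → Fin n → Fin n → Digraph n
deleteEdge E a c u w = E u w × ¬ (u ≡ a × w ≡ c)

addEdge : ∀ {n} → Digraph n → Fin n → Fin n → Digraph n
addEdge E a c u w = E u w ⊎ (u ≡ a × w ≡ c)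

record SignedSet : Set₁ where
  field
    Carrier : Set
    _≈_     : Carrier → Carrier → Set
    ≈-refl  : ∀ {x} → x ≈ x
    ≈-sym   : ∀ {x y} → x ≈ y → y ≈ x
    ≈-trans : ∀ {x y z} → x ≈ y → y ≈ z → x ≈ z
    weight  : Carrier → Sign
    weight-cong : ∀ {x y} → x ≈ y → weight x ≡ weight y

open SignedSet public

_⊖_ : SignedSet → SignedSet → SignedSet
A ⊖ B = record
  { Carrier = Carrier A ⊎ Carrier B
  ; _≈_ = R
  ; ≈-refl = λ { {inj₁ _} → ≈-refl A ; {inj₂ _} → ≈-refl B }
  ; ≈-sym = λ { {inj₁ _} {inj₁ _} p → ≈-sym A p ; {inj₂ _} {inj₂ _} p → ≈-sym B p }
  ; ≈-trans = λ { {inj₁ _} {inj₁ _} {inj₁ _} p q → ≈-trans A p q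
                ; {inj₂ _} {inj₂ _} {inj₂ _} p q → ≈-trans B p q }
  ; weight = wt
  ; weight-cong = λ { {inj₁ _} {inj₁ _} p → weight-cong A p
                    ; {inj₂ _} {inj₂ _} p → cong opposite (weight-cong B p) }
  }
  where
  R : Carrier A ⊎ Carrier B → Carrier A ⊎ Carrier B → Set
  R (inj₁ x) (inj₁ y) = _≈_ A x y
  R (inj₂ x) (inj₂ y) = _≈_ B x y
  R _ _ = ⊥
  wt : Carrier A ⊎ Carrier B → Sign
  wt (inj₁ x) = weight A x
  wt (inj₂ x) = opposite (weight B x)

_≈⊔_ : {S T : SignedSet} → Carrier S ⊎ Carrier T → Carrier S ⊎ Carrier T → Set
_≈⊔_ {S} (inj₁ x) (inj₁ y) = _≈_ S x y
_≈⊔_ {T = T} (inj₂ x) (inj₂ y) = _≈_ T x y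
_≈⊔_ _ _ = ⊥

SignCond : (S T : SignedSet) → Carrier S ⊎ Carrier T → Carrier S ⊎ Carrier T → Set
SignCond S T (inj₁ x) (inj₁ y) = weight S y ≡ opposite (weight S x)
SignCond S T (inj₂ x) (inj₂ y) = weight T y ≡ opposite (weight T x)
SignCond S T (inj₁ x) (inj₂ y) = weight T y ≡ weight S x
SignCond S T (inj₂ x) (inj₁ y) = weight S y ≡ weight T x

record Sijection (S T : SignedSet) : Set where
  field
    φ      : Carrier S ⊎ Carrier T → Carrier S ⊎ Carrier T
    φ-cong : ∀ {x y} → _≈⊔_ {S} {T} x y → _≈⊔_ {S} {T} (φ x) (φ y)
    φ-invol : ∀ x → _≈⊔_ {S} {T} (φ (φ x)) x
    φ-sign : ∀ x → SignCond S T x (φ x)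

-- Topological orderings: bijections f : Fin n → Fin n (values 0..n-1
-- standing for 1..n) with f u > f w for every edge u → w.

record TopoOrdering {n : ℕ} (E : Digraph n) : Set where
  constructor topo
  field
    ord       : Fin n → Fin n
    bijective : Bijective _≡_ _≡_ ord
    respects  : ∀ u w → E u w → ord w < ord u

Topo : ∀ {n} → Digraph n → SignedSet
Topo {n} E = record
  { Carrier = TopoOrdering E
  ; _≈_ = λ f h → ∀ u → TopoOrdering.ord f u ≡ TopoOrdering.ord h u
  ; ≈-refl = λ u → refl
  ; ≈-sym = λ p u → sym (p u)
  ; ≈-trans = λ p q u → trans (p u) (q u)
  ; weight = λ _ → plus
  ; weight-cong = λ _ → refl
  }

-- Every topological ordering of G₁ puts g either below b or above it.
-- Those with g below b are exactly the orderings of G (the only edge G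
-- adds is b → g), and those with b below g are exactly the orderings of
-- G₂: its new edge g → b is then respected, and the deleted edge v → b is
-- implied by the path v → g → b.  So Topo(G₁) is the disjoint union of
-- Topo(G) and Topo(G₂), and the sijection pairs each ordering of G and
-- of G₂ with the same ordering regarded in G₁.
module Submission where

open import Defs
open import Data.Nat using (ℕ)
open import Data.Fin using (Fin; _<_)
open import Data.Fin.Properties using (_<?_; _≟_; <-cmp; <-trans; <-asym)
open import Data.Product using (_,_; proj₁)
open import Data.Sum using (_⊎_; inj₁; inj₂)
open import Relation.Nullary using (¬_; Dec; yes; no; contradiction)
open import Relation.Binary.Core using (_⇒_)
open import Relation.Binary.Definitions using (tri<; tri≈; tri>)
open import Relation.Binary.Construct.Closure.Transitive using (TransClosure; [_]; _∷_)
open import Relation.Binary.PropositionalEquality using (_≡_; _≢_; refl; sym; subst₂)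

open TopoOrdering

module _ {n : ℕ} where

  respects⁺ : {E : Digraph n} (t : TopoOrdering E) →
              ∀ {u w} → TransClosure E u w → ord t w < ord t u
  respects⁺ t [ e ]    = respects t _ _ e
  respects⁺ t (e ∷ p) = <-trans (respects⁺ t p) (respects t _ _ e)

  restrict⁺ : {E F : Digraph n} → F ⇒ TransClosure E → TopoOrdering E → TopoOrdering F
  restrict⁺ F⇒E⁺ t = topo (ord t) (bijective t) (λ _ _ e → respects⁺ t (F⇒E⁺ e))

  restrict : {E F : Digraph n} → F ⇒ E → TopoOrdering E → TopoOrdering F
  restrict F⇒E = restrict⁺ (λ e → [ F⇒E e ])

  addEdge-topo : {E : Digraph n} {a c : Fin n} (t : TopoOrdering E) →
                 ord t c < ord t a → TopoOrdering (addEdge E a c)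
  addEdge-topo {E} {a} {c} t c<a = topo (ord t) (bijective t) resp
    where
    resp : ∀ u w → addEdge E a c u w → ord t w < ord t u
    resp u w (inj₁ e)             = respects t u w e
    resp _ _ (inj₂ (refl , refl)) = c<a

  ord-≮⇒> : {E : Digraph n} (t : TopoOrdering E) {a c : Fin n} →
            a ≢ c → ¬ ord t c < ord t a → ord t a < ord t c
  ord-≮⇒> t {a} {c} a≢c c≮a with <-cmp (ord t a) (ord t c)
  ... | tri< a<c _ _  = a<c
  ... | tri≈ _ a≡c _  = contradiction (proj₁ (bijective t) a≡c) a≢c
  ... | tri> _ _ c<a  = contradiction c<a c≮a

  deleteEdge-⇒ : {E : Digraph n} {a c : Fin n} → deleteEdge E a c ⇒ E
  deleteEdge-⇒ = proj₁

  ⇒-addEdge-deleteEdge : {E : Digraph n} {a c : Fin n} → E ⇒ addEdge (deleteEdge E a c) a c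
  ⇒-addEdge-deleteEdge {a = a} {c} {u} {w} e with u ≟ a | w ≟ c
  ... | yes u≡a | yes w≡c = inj₂ (u≡a , w≡c)
  ... | yes _   | no w≢c  = inj₁ (e , λ (_ , w≡c) → w≢c w≡c)
  ... | no u≢a  | _       = inj₁ (e , λ (u≡a , _) → u≢a u≡a)

-- The orderings of F split along the order of a and c into those of E
-- (c below a) and those of H (a below c).
module TopoSplit {n : ℕ} {E F H : Digraph n} {a c : Fin n} (a≢c : a ≢ c)
    (F⇒E : F ⇒ E) (E⇒F+ac : E ⇒ addEdge F a c) (ac∈E : E a c)
    (H⇒F+ca : H ⇒ addEdge F c a) (ca∈H : H c a) (F⇒H⁺ : F ⇒ TransClosure H) where

  private
    S T : SignedSet
    S = Topo E
    T = Topo F ⊖ Topo H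

    C : Set
    C = Carrier S ⊎ Carrier T

    _≈C_ : C → C → Set
    _≈C_ = _≈⊔_ {S} {T}

  split : (t : TopoOrdering F) → Dec (ord t c < ord t a) → C
  split t (yes c<a) = inj₁ (restrict E⇒F+ac (addEdge-topo t c<a))
  split t (no c≮a)  = inj₂ (inj₂ (restrict H⇒F+ca (addEdge-topo t (ord-≮⇒> t a≢c c≮a))))

  φ : C → C
  φ (inj₁ s)        = inj₂ (inj₁ (restrict F⇒E s))
  φ (inj₂ (inj₁ t)) = split t (ord t c <? ord t a)
  φ (inj₂ (inj₂ h)) = inj₂ (inj₁ (restrict⁺ F⇒H⁺ h))

  split-cong : ∀ t t′ → (∀ u → ord t u ≡ ord t′ u) →
               ∀ d d′ → split t d ≈C split t′ d′
  split-cong t t′ t≈t′ (yes _)   (yes _)    = t≈t′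
  split-cong t t′ t≈t′ (no _)    (no _)     = t≈t′
  split-cong t t′ t≈t′ (yes c<a) (no c≮a′)  = contradiction (subst₂ _<_ (t≈t′ c) (t≈t′ a) c<a) c≮a′
  split-cong t t′ t≈t′ (no c≮a)  (yes c<a′) =
    contradiction (subst₂ _<_ (sym (t≈t′ c)) (sym (t≈t′ a)) c<a′) c≮a

  φ-cong : ∀ {x y} → x ≈C y → φ x ≈C φ y
  φ-cong {inj₁ _}        {inj₁ _}        s≈s′ = s≈s′
  φ-cong {inj₂ (inj₁ t)} {inj₂ (inj₁ t′)} t≈t′ =
    split-cong t t′ t≈t′ (ord t c <? ord t a) (ord t′ c <? ord t′ a)
  φ-cong {inj₂ (inj₂ _)} {inj₂ (inj₂ _)} h≈h′ = h≈h′

  φ-invol : ∀ x → φ (φ x) ≈C x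
  φ-invol (inj₁ s) with ord s c <? ord s a
  ... | yes _   = λ _ → refl
  ... | no c≮a  = contradiction (respects s a c ac∈E) c≮a
  φ-invol (inj₂ (inj₁ t)) with ord t c <? ord t a
  ... | yes _ = λ _ → refl
  ... | no _  = λ _ → refl
  φ-invol (inj₂ (inj₂ h)) with ord h c <? ord h a
  ... | yes c<a = contradiction (respects h c a ca∈H) (<-asym c<a)
  ... | no _    = λ _ → refl

  φ-sign : ∀ x → SignCond S T x (φ x)
  φ-sign (inj₁ _) = refl
  φ-sign (inj₂ (inj₁ t)) with ord t c <? ord t a
  ... | yes _ = refl
  ... | no _  = refl
  φ-sign (inj₂ (inj₂ _)) = refl

  sijection : Sijection (Topo E) (Topo F ⊖ Topo H)
  sijection = record
    { φ = φ ; φ-cong = λ {x} {y} → φ-cong {x} {y} ; φ-invol = φ-invol ; φ-sign = φ-sign }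

lemma2p13 : (n : ℕ) (E : Digraph n) (b g v : Fin n)
    → ¬ b ≡ g → ¬ b ≡ v → ¬ g ≡ v
    → E v g → E v b → E b g
    → Sijection (Topo E)
        (Topo (deleteEdge E b g)
          ⊖ Topo (addEdge (deleteEdge (deleteEdge E v b) b g) g b))
lemma2p13 n E b g v b≢g b≢v _ vg∈E _ bg∈E =
  TopoSplit.sijection b≢g (deleteEdge-⇒ {E = E}) (⇒-addEdge-deleteEdge {E = E})
    bg∈E G₂⇒G₁+gb (inj₂ (refl , refl)) G₁⇒G₂⁺
  where
  G₁ G₂ : Digraph n
  G₁ = deleteEdge E b g
  G₂ = addEdge (deleteEdge (deleteEdge E v b) b g) g b

  G₂⇒G₁+gb : G₂ ⇒ addEdge G₁ g b
  G₂⇒G₁+gb (inj₁ ((e , _) , not-bg)) = inj₁ (e , not-bg)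
  G₂⇒G₁+gb (inj₂ gb)                  = inj₂ gb

  vg∈G₂ : G₂ v g
  vg∈G₂ = inj₁ ((vg∈E , λ (_ , g≡b) → b≢g (sym g≡b)) , λ (v≡b , _) → b≢v (sym v≡b))

  G₁⇒G₂⁺ : G₁ ⇒ TransClosure G₂
  G₁⇒G₂⁺ {u} {w} (e , not-bg) with ⇒-addEdge-deleteEdge {E = E} {v} {b} {u} {w} e
  ... | inj₂ (refl , refl) = vg∈G₂ ∷ [ inj₂ (refl , refl) ]
  ... | inj₁ e′            = [ inj₁ (e′ , not-bg) ]
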